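{- Let $g: \mathbb{N} \to \mathbb{Z}$ be an arithmetic function with $g(1) = 1$. Then for every prime $p$, \[A_p^g(X) \equiv X\left(X^{p-1} - g(p)\right) \pmod p.\]
   Context: For an arithmetic function $g:\mathbb{N}\to\mathbb{Z}$ with $g(1)=1$, the polynomials $P_n^g(X) \in \mathbb{Q}[X]$ are defined by $\sum_{n=0}^\infty P_n^g(X) q^n = \exp\big(X \sum_{n=1}^\infty g(n)\frac{q^n}{n}\big)$, and $A_n^g(X) := n!\,P_n^g(X)$, which lies in $\mathbb{Z}[X]$. The congruence is coefficientwise in $\mathbb{Z}[X]$. -}

module Defs where

open import Data.Nat as ℕ using (ℕ; zero; suc; _!; _≟_)
open import Data.Nat.Properties using (_!≢0)
open import Data.Integer as ℤ using (ℤ)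
open import Data.Rational as ℚ using (ℚ; 0ℚ; 1ℚ; _+_; _*_; _-_; _/_)
open import Relation.Nullary using (yes; no)

Series : Set
Series = ℕ → ℚ

sumTo : ℕ → (ℕ → ℚ) → ℚ
sumTo zero    f = f zero
sumTo (suc n) f = sumTo n f + f (suc n)

_⊛_ : Series → Series → Series
(a ⊛ b) n = sumTo n (λ i → a i * b (n ℕ.∸ i))

one : Series
one zero    = 1ℚ
one (suc _) = 0ℚ

_^ˢ_ : Series → ℕ → Series
s ^ˢ zero  = one
s ^ˢ suc k = s ⊛ (s ^ˢ k)

Lg : (ℕ → ℤ) → Series
Lg g zero    = 0ℚ
Lg g (suc m) = g (suc m) / suc m

-- exp(X · L_g(q)) = Σ_k X^k L_g(q)^k / k!.
-- P g n k = coefficient of X^k q^n, i.e. the X^k–coefficient of P_n^g(X).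
P : (ℕ → ℤ) → ℕ → ℕ → ℚ
P g n k = ((Lg g ^ˢ k) n) * (ℤ.+ 1 / (k !)) {{k !≢0}}

-- A g n k = X^k–coefficient of A_n^g(X) = n! P_n^g(X).
A : (ℕ → ℤ) → ℕ → ℕ → ℚ
A g n k = (ℤ.+ (n !) / 1) * P g n k

-- X^k–coefficient of X (X^{p-1} - g(p)) = X^p - g(p) X.
rhs : (ℕ → ℤ) → ℕ → ℕ → ℚ
rhs g p k = ind p k - (ind 1 k * (g p / 1))
  where
  ind : ℕ → ℕ → ℚ
  ind a b with a ≟ b
  ... | yes _ = 1ℚ
  ... | no  _ = 0ℚ

{-# OPTIONS --safe #-}
-- Write L = Σ_{n≥1} g(n) qⁿ/n and A(n,k) = n! [qⁿ] Lᵏ/k!.  Applying θ = q d/dq to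
-- L^{k+1} gives A(n+1,k+1) = Σ_j g(j+1) n!/(n-j)! A(n-j,k), so every A(n,k) is an
-- integer.  Reading off L^{k+1} = L·Lᵏ directly gives
-- (k+1) A(p,k+1) = Σ_i g(i) p!/(i (p-i)!) A(p-i,k), where p!/(i (p-i)!) = C(p,i) (i-1)!
-- is divisible by p for 0 < i < p and the term i = p vanishes; hence p ∣ A(p,k) for
-- 1 < k < p.  Since A(p,0) = 0, A(p,p) = 1 and A(p,1) = (p-1)! g(p), what remains is
-- Wilson's theorem, which is the case g ≡ 1: there A_n(X) = X(X+1)⋯(X+n-1) has
-- coefficient sum n!, and reducing p! = Σ_k A(p,k) modulo p gives (p-1)! + 1 ≡ 0.
module Submission where

open import Defs
open import Data.Nat using (ℕ)
open import Data.Nat.Primality using (Prime)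
open import Data.Integer using (ℤ; +_)
open import Data.Rational using (ℚ; _/_; _-_)
open import Data.Product using (∃)
open import Relation.Binary.PropositionalEquality using (_≡_)

open import Data.Empty using (⊥-elim)
import Data.Integer as ℤ
open import Data.Integer.Divisibility.Signed as Signed using (∣ᵤ⇒∣)
import Data.Integer.Properties as ℤₚ
open import Data.Integer.Tactic.RingSolver using () renaming (solve-∀ to ℤ-solve-∀)
open import Data.Nat as ℕ using (zero; suc; _!; _∸_; _≤_; _<_; z≤n; s≤s; NonZero; _≟_)
open import Data.Nat.Combinatorics using (k![n∸k]!∣n!)
open import Data.Nat.Divisibility using (_∣_; divides; ∣⇒≤; m≤n⇒m!∣n!)
open import Data.Nat.Primality using (prime; euclidsLemma; prime⇒nonTrivial)
import Data.Nat.Properties as ℕₚ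
open import Data.Nat.Properties using (_!≢0)
open import Data.Product using (_,_)
open import Data.Rational as ℚ using (0ℚ; 1ℚ; _+_; _*_; toℚᵘ)
import Data.Rational.Properties as ℚₚ
open import Data.Rational.Unnormalised using (mkℚᵘ; *≡*) renaming (_≃_ to _≃ᵘ_; _+_ to _+ᵘ_; _*_ to _*ᵘ_)
import Data.Rational.Unnormalised.Properties as ℚᵘₚ
open import Data.Sum using (inj₁; inj₂)
open import Function using (_∘_)
open import Level using (0ℓ)
open import Relation.Binary.Definitions using (tri<; tri≈; tri>)
open import Relation.Binary.PropositionalEquality using (_≢_; refl; sym; trans; cong; cong₂; subst; module ≡-Reasoning)
open import Relation.Nullary using (yes; no; ¬_)
open import Relation.Nullary.Decidable using (dec⇒maybe)
open import Tactic.RingSolver using (solve-∀)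
open import Tactic.RingSolver.Core.AlmostCommutativeRing using (AlmostCommutativeRing; fromCommutativeRing)

private
  -- The zero test lets the normaliser drop cancelling monomials such as v - v.
  ℚ-ring : AlmostCommutativeRing 0ℓ 0ℓ
  ℚ-ring = fromCommutativeRing ℚₚ.+-*-commutativeRing (λ x → dec⇒maybe (0ℚ ℚ.≟ x))

ι : ℤ → ℚ
ι z = z / 1

ιₙ : ℕ → ℚ
ιₙ n = ι (+ n)

invFact : ℕ → ℚ
invFact k = (+ 1 / k !) {{k !≢0}}

toℚᵘ-ι : ∀ z → toℚᵘ (ι z) ≃ᵘ mkℚᵘ z 0
toℚᵘ-ι z = ℚₚ.toℚᵘ-fromℚᵘ (mkℚᵘ z 0)

ι-+ : ∀ a b → ι (a ℤ.+ b) ≡ ι a + ι b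
ι-+ a b = ℚₚ.toℚᵘ-injective (begin
  toℚᵘ (ι (a ℤ.+ b))         ≈⟨ toℚᵘ-ι (a ℤ.+ b) ⟩
  mkℚᵘ (a ℤ.+ b) 0           ≈⟨ *≡* (+-over-1 a b) ⟩
  mkℚᵘ a 0 +ᵘ mkℚᵘ b 0       ≈⟨ ℚᵘₚ.+-cong (toℚᵘ-ι a) (toℚᵘ-ι b) ⟨
  toℚᵘ (ι a) +ᵘ toℚᵘ (ι b)   ≈⟨ ℚₚ.toℚᵘ-homo-+ (ι a) (ι b) ⟨
  toℚᵘ (ι a + ι b)           ∎)
  where
  open ℚᵘₚ.≃-Reasoning
  +-over-1 : ∀ a b → (a ℤ.+ b) ℤ.* + 1 ≡ (a ℤ.* + 1 ℤ.+ b ℤ.* + 1) ℤ.* + 1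
  +-over-1 = ℤ-solve-∀

ι-* : ∀ a b → ι (a ℤ.* b) ≡ ι a * ι b
ι-* a b = ℚₚ.toℚᵘ-injective (begin
  toℚᵘ (ι (a ℤ.* b))         ≈⟨ toℚᵘ-ι (a ℤ.* b) ⟩
  mkℚᵘ (a ℤ.* b) 0           ≈⟨ *≡* refl ⟩
  mkℚᵘ a 0 *ᵘ mkℚᵘ b 0       ≈⟨ ℚᵘₚ.*-cong (toℚᵘ-ι a) (toℚᵘ-ι b) ⟨
  toℚᵘ (ι a) *ᵘ toℚᵘ (ι b)   ≈⟨ ℚₚ.toℚᵘ-homo-* (ι a) (ι b) ⟨
  toℚᵘ (ι a * ι b)           ∎)
  where open ℚᵘₚ.≃-Reasoning

ι-injective : ∀ {a b} → ι a ≡ ι b → a ≡ b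
ι-injective {a} {b} ιa≡ιb
  with ℚᵘₚ.≃-trans (ℚᵘₚ.≃-sym (toℚᵘ-ι a)) (ℚᵘₚ.≃-trans (ℚₚ.toℚᵘ-cong ιa≡ιb) (toℚᵘ-ι b))
... | *≡* a*1≡b*1 = trans (sym (ℤₚ.*-identityʳ a)) (trans a*1≡b*1 (ℤₚ.*-identityʳ b))

ιₙ-+ : ∀ m n → ιₙ (m ℕ.+ n) ≡ ιₙ m + ιₙ n
ιₙ-+ m n = ι-+ (+ m) (+ n)

ιₙ-* : ∀ m n → ιₙ (m ℕ.* n) ≡ ιₙ m * ιₙ n
ιₙ-* m n = trans (cong ι (ℤₚ.pos-* m n)) (ι-* (+ m) (+ n))

ιₙ-*-/-* : ∀ z m n .{{_ : NonZero n}} →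
           ιₙ (suc m) * (z / (suc m ℕ.* n)) {{ℕₚ.m*n≢0 (suc m) n}} ≡ z / n
ιₙ-*-/-* z m (suc n) = ℚₚ.toℚᵘ-injective (begin
  toℚᵘ (ιₙ (suc m) * ℚ.fromℚᵘ (mkℚᵘ z d))                  ≈⟨ ℚₚ.toℚᵘ-homo-* (ιₙ (suc m)) _ ⟩
  toℚᵘ (ιₙ (suc m)) *ᵘ toℚᵘ (ℚ.fromℚᵘ (mkℚᵘ z d))         ≈⟨ ℚᵘₚ.*-cong (toℚᵘ-ι (+ suc m)) (ℚₚ.toℚᵘ-fromℚᵘ (mkℚᵘ z d)) ⟩
  mkℚᵘ (+ suc m) 0 *ᵘ mkℚᵘ z d                            ≈⟨ *≡* (cancel (+ suc m) z (+ suc n)) ⟩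
  mkℚᵘ z n                                                ≈⟨ ℚₚ.toℚᵘ-fromℚᵘ (mkℚᵘ z n) ⟨
  toℚᵘ (ℚ.fromℚᵘ (mkℚᵘ z n))                              ∎)
  where
  open ℚᵘₚ.≃-Reasoning
  d = n ℕ.+ m ℕ.* suc n
  cancel : ∀ s z t → (s ℤ.* z) ℤ.* t ≡ z ℤ.* (+ 1 ℤ.* (s ℤ.* t))
  cancel = ℤ-solve-∀

ιₙ-*-/ : ∀ z m → ιₙ (suc m) * (z / suc m) ≡ ι z
ιₙ-*-/ z m = trans (cong (λ d → ιₙ (suc m) * (z / suc d)) (sym (ℕₚ.*-identityʳ m))) (ιₙ-*-/-* z m 1)

ιₙ-*-invFact : ∀ k → ιₙ (suc k) * invFact (suc k) ≡ invFact k
ιₙ-*-invFact k = ιₙ-*-/-* (+ 1) k (k !) {{k !≢0}}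

ιₙ-!-*-invFact : ∀ k → ιₙ (k !) * invFact k ≡ 1ℚ
ιₙ-!-*-invFact k = inverse (k !) {{k !≢0}}
  where
  inverse : ∀ n .{{_ : NonZero n}} → ιₙ n * (+ 1 / n) ≡ 1ℚ
  inverse (suc m) = ιₙ-*-/ (+ 1) m

-- Finite sums and power series

sumTo-cong : ∀ n {f h : ℕ → ℚ} → (∀ i → i ≤ n → f i ≡ h i) → sumTo n f ≡ sumTo n h
sumTo-cong zero    f≡h = f≡h 0 z≤n
sumTo-cong (suc n) f≡h =
  cong₂ _+_ (sumTo-cong n (λ i i≤n → f≡h i (ℕₚ.m≤n⇒m≤1+n i≤n))) (f≡h (suc n) ℕₚ.≤-refl)

sumTo-+ : ∀ n (f h : ℕ → ℚ) → sumTo n (λ i → f i + h i) ≡ sumTo n f + sumTo n h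
sumTo-+ zero    f h = refl
sumTo-+ (suc n) f h =
  trans (cong (_+ (f (suc n) + h (suc n))) (sumTo-+ n f h))
        (interchange (sumTo n f) (sumTo n h) (f (suc n)) (h (suc n)))
  where
  interchange : ∀ a b c d → (a + b) + (c + d) ≡ (a + c) + (b + d)
  interchange = solve-∀ ℚ-ring

sumTo-*ˡ : ∀ n c (f : ℕ → ℚ) → sumTo n (λ i → c * f i) ≡ c * sumTo n f
sumTo-*ˡ zero    c f = refl
sumTo-*ˡ (suc n) c f =
  trans (cong (_+ c * f (suc n)) (sumTo-*ˡ n c f)) (sym (ℚₚ.*-distribˡ-+ c (sumTo n f) (f (suc n))))

sumTo-*ʳ : ∀ n c (f : ℕ → ℚ) → sumTo n (λ i → f i * c) ≡ sumTo n f * c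
sumTo-*ʳ zero    c f = refl
sumTo-*ʳ (suc n) c f =
  trans (cong (_+ f (suc n) * c) (sumTo-*ʳ n c f)) (sym (ℚₚ.*-distribʳ-+ c (sumTo n f) (f (suc n))))

sumTo-head : ∀ n (f : ℕ → ℚ) → sumTo (suc n) f ≡ f 0 + sumTo n (f ∘ suc)
sumTo-head zero    f = refl
sumTo-head (suc n) f = trans (cong (_+ f (suc (suc n))) (sumTo-head n f)) (ℚₚ.+-assoc (f 0) _ _)

sumTo-zero : ∀ n (f : ℕ → ℚ) → (∀ i → i ≤ n → f i ≡ 0ℚ) → sumTo n f ≡ 0ℚ
sumTo-zero n f f≡0 = trans (sumTo-cong n f≡0) (zeros n)
  where
  zeros : ∀ n → sumTo n (λ _ → 0ℚ) ≡ 0ℚ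
  zeros zero    = refl
  zeros (suc n) = cong (_+ 0ℚ) (zeros n)

sumTo-single : ∀ n (f : ℕ → ℚ) → (∀ j → j < n → f (suc j) ≡ 0ℚ) → sumTo n f ≡ f 0
sumTo-single zero    f rest≡0 = refl
sumTo-single (suc n) f rest≡0 = begin
  sumTo (suc n) f           ≡⟨ sumTo-head n f ⟩
  f 0 + sumTo n (f ∘ suc)   ≡⟨ cong (_+_ (f 0)) (sumTo-zero n (f ∘ suc) (λ j j≤n → rest≡0 j (s≤s j≤n))) ⟩
  f 0 + 0ℚ                  ≡⟨ ℚₚ.+-identityʳ (f 0) ⟩
  f 0                       ∎
  where open ≡-Reasoning

sumTo-shift : ∀ n (f : ℕ → ℚ) → f 0 ≡ 0ℚ → f (suc n) ≡ 0ℚ → sumTo n (f ∘ suc) ≡ sumTo n f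
sumTo-shift n f f0≡0 fn≡0 = begin
  sumTo n (f ∘ suc)               ≡⟨ ℚₚ.+-identityˡ _ ⟨
  0ℚ + sumTo n (f ∘ suc)          ≡⟨ cong (_+ sumTo n (f ∘ suc)) f0≡0 ⟨
  f 0 + sumTo n (f ∘ suc)         ≡⟨ sumTo-head n f ⟨
  sumTo n f + f (suc n)           ≡⟨ cong (_+_ (sumTo n f)) fn≡0 ⟩
  sumTo n f + 0ℚ                  ≡⟨ ℚₚ.+-identityʳ _ ⟩
  sumTo n f                       ∎
  where open ≡-Reasoning

sumTo-closed : (Q : ℚ → Set) → (∀ {x y} → Q x → Q y → Q (x + y)) →
               ∀ n (f : ℕ → ℚ) → (∀ i → i ≤ n → Q (f i)) → Q (sumTo n f)
sumTo-closed Q +-closed zero    f Qf = Qf 0 z≤n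
sumTo-closed Q +-closed (suc n) f Qf =
  +-closed (sumTo-closed Q +-closed n f (λ i i≤n → Qf i (ℕₚ.m≤n⇒m≤1+n i≤n))) (Qf (suc n) ℕₚ.≤-refl)

shift : Series → Series
shift s i = s (suc i)

⊛-suc : ∀ a b n → (a ⊛ b) (suc n) ≡ a 0 * b (suc n) + (shift a ⊛ b) n
⊛-suc a b n = sumTo-head n (λ i → a i * b (suc n ∸ i))

⊛-suc′ : ∀ a b n → (a ⊛ b) (suc n) ≡ (a ⊛ shift b) n + a (suc n) * b 0
⊛-suc′ a b n = cong₂ _+_
  (sumTo-cong n (λ i i≤n → cong (λ m → a i * b m) (ℕₚ.+-∸-assoc 1 i≤n)))
  (cong (λ m → a (suc n) * b m) (ℕₚ.n∸n≡0 n))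

⊛-comm : ∀ a b n → (a ⊛ b) n ≡ (b ⊛ a) n
⊛-comm a b zero    = ℚₚ.*-comm (a 0) (b 0)
⊛-comm a b (suc n) = begin
  (a ⊛ b) (suc n)                    ≡⟨ ⊛-suc a b n ⟩
  a 0 * b (suc n) + (shift a ⊛ b) n  ≡⟨ cong (_+_ (a 0 * b (suc n))) (⊛-comm (shift a) b n) ⟩
  a 0 * b (suc n) + (b ⊛ shift a) n  ≡⟨ swap (a 0) (b (suc n)) ((b ⊛ shift a) n) ⟩
  (b ⊛ shift a) n + b (suc n) * a 0  ≡⟨ ⊛-suc′ b a n ⟨
  (b ⊛ a) (suc n)                    ∎
  where
  open ≡-Reasoning
  swap : ∀ x y z → x * y + z ≡ z + y * x
  swap = solve-∀ ℚ-ring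

⊛-congˡ : ∀ {a a′} b n → (∀ i → a i ≡ a′ i) → (a ⊛ b) n ≡ (a′ ⊛ b) n
⊛-congˡ b n a≡a′ = sumTo-cong n (λ i _ → cong (_* b (n ∸ i)) (a≡a′ i))

⊛-congʳ : ∀ a {b b′} n → (∀ i → b i ≡ b′ i) → (a ⊛ b) n ≡ (a ⊛ b′) n
⊛-congʳ a n b≡b′ = sumTo-cong n (λ i _ → cong (a i *_) (b≡b′ (n ∸ i)))

⊛-*ʳ : ∀ x a b n → (a ⊛ (λ i → x * b i)) n ≡ x * (a ⊛ b) n
⊛-*ʳ x a b n = trans (sumTo-cong n (λ i _ → move x (a i) (b (n ∸ i)))) (sumTo-*ˡ n x _)
  where
  move : ∀ x y z → y * (x * z) ≡ x * (y * z)
  move = solve-∀ ℚ-ring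

⊛-affineˡ : ∀ x a b c n → ((λ i → x * a i + b i) ⊛ c) n ≡ x * (a ⊛ c) n + (b ⊛ c) n
⊛-affineˡ x a b c n = begin
  sumTo n (λ i → (x * a i + b i) * c (n ∸ i))
    ≡⟨ sumTo-cong n (λ i _ → expand x (a i) (b i) (c (n ∸ i))) ⟩
  sumTo n (λ i → x * (a i * c (n ∸ i)) + b i * c (n ∸ i))
    ≡⟨ sumTo-+ n _ _ ⟩
  sumTo n (λ i → x * (a i * c (n ∸ i))) + (b ⊛ c) n
    ≡⟨ cong (_+ (b ⊛ c) n) (sumTo-*ˡ n x _) ⟩
  x * (a ⊛ c) n + (b ⊛ c) n ∎
  where
  open ≡-Reasoning
  expand : ∀ x a b c → (x * a + b) * c ≡ x * (a * c) + b * c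
  expand = solve-∀ ℚ-ring

⊛-assoc : ∀ a b c n → ((a ⊛ b) ⊛ c) n ≡ (a ⊛ (b ⊛ c)) n
⊛-assoc a b c zero    = ℚₚ.*-assoc (a 0) (b 0) (c 0)
⊛-assoc a b c (suc n) = begin
  ((a ⊛ b) ⊛ c) (suc n)
    ≡⟨ ⊛-suc (a ⊛ b) c n ⟩
  a 0 * b 0 * c (suc n) + (shift (a ⊛ b) ⊛ c) n
    ≡⟨ cong (_+_ (a 0 * b 0 * c (suc n))) (⊛-congˡ c n (⊛-suc a b)) ⟩
  a 0 * b 0 * c (suc n) + ((λ i → a 0 * shift b i + (shift a ⊛ b) i) ⊛ c) n
    ≡⟨ cong (_+_ (a 0 * b 0 * c (suc n))) (⊛-affineˡ (a 0) (shift b) (shift a ⊛ b) c n) ⟩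
  a 0 * b 0 * c (suc n) + (a 0 * (shift b ⊛ c) n + ((shift a ⊛ b) ⊛ c) n)
    ≡⟨ cong (λ z → a 0 * b 0 * c (suc n) + (a 0 * (shift b ⊛ c) n + z)) (⊛-assoc (shift a) b c n) ⟩
  a 0 * b 0 * c (suc n) + (a 0 * (shift b ⊛ c) n + (shift a ⊛ (b ⊛ c)) n)
    ≡⟨ factor (a 0) (b 0) (c (suc n)) ((shift b ⊛ c) n) ((shift a ⊛ (b ⊛ c)) n) ⟩
  a 0 * (b 0 * c (suc n) + (shift b ⊛ c) n) + (shift a ⊛ (b ⊛ c)) n
    ≡⟨ cong (λ z → a 0 * z + (shift a ⊛ (b ⊛ c)) n) (⊛-suc b c n) ⟨
  a 0 * (b ⊛ c) (suc n) + (shift a ⊛ (b ⊛ c)) n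
    ≡⟨ ⊛-suc a (b ⊛ c) n ⟨
  (a ⊛ (b ⊛ c)) (suc n) ∎
  where
  open ≡-Reasoning
  factor : ∀ a b c x y → a * b * c + (a * x + y) ≡ a * (b * c + x) + y
  factor = solve-∀ ℚ-ring

⊛-identityˡ : ∀ a n → (one ⊛ a) n ≡ a n
⊛-identityˡ a n = trans (sumTo-single n _ (λ j _ → ℚₚ.*-zeroˡ (a (n ∸ suc j)))) (ℚₚ.*-identityˡ (a n))

⊛-identityʳ : ∀ a n → (a ⊛ one) n ≡ a n
⊛-identityʳ a n = trans (⊛-comm a one n) (⊛-identityˡ a n)

θ : Series → Series
θ s n = ιₙ n * s n

θ-⊛ : ∀ a b n → θ (a ⊛ b) n ≡ (θ a ⊛ b) n + (a ⊛ θ b) n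
θ-⊛ a b n = begin
  ιₙ n * sumTo n (λ i → a i * b (n ∸ i))                                        ≡⟨ sumTo-*ˡ n (ιₙ n) _ ⟨
  sumTo n (λ i → ιₙ n * (a i * b (n ∸ i)))                                      ≡⟨ sumTo-cong n term ⟩
  sumTo n (λ i → ιₙ i * a i * b (n ∸ i) + a i * (ιₙ (n ∸ i) * b (n ∸ i)))       ≡⟨ sumTo-+ n _ _ ⟩
  (θ a ⊛ b) n + (a ⊛ θ b) n                                                     ∎
  where
  open ≡-Reasoning
  split : ∀ x y u v → (x + y) * (u * v) ≡ x * u * v + u * (y * v)
  split = solve-∀ ℚ-ring
  term : ∀ i → i ≤ n → ιₙ n * (a i * b (n ∸ i)) ≡ ιₙ i * a i * b (n ∸ i) + a i * (ιₙ (n ∸ i) * b (n ∸ i))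
  term i i≤n = begin
    ιₙ n * (a i * b (n ∸ i))
      ≡⟨ cong (λ m → ιₙ m * (a i * b (n ∸ i))) (ℕₚ.m+[n∸m]≡n i≤n) ⟨
    ιₙ (i ℕ.+ (n ∸ i)) * (a i * b (n ∸ i))
      ≡⟨ cong (_* (a i * b (n ∸ i))) (ιₙ-+ i (n ∸ i)) ⟩
    (ιₙ i + ιₙ (n ∸ i)) * (a i * b (n ∸ i))
      ≡⟨ split (ιₙ i) (ιₙ (n ∸ i)) (a i) (b (n ∸ i)) ⟩
    ιₙ i * a i * b (n ∸ i) + a i * (ιₙ (n ∸ i) * b (n ∸ i)) ∎

θ-^ˢ : ∀ s k n → θ (s ^ˢ suc k) n ≡ ιₙ (suc k) * (θ s ⊛ (s ^ˢ k)) n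
θ-^ˢ s zero n = begin
  ιₙ n * (s ⊛ one) n   ≡⟨ cong (ιₙ n *_) (⊛-identityʳ s n) ⟩
  θ s n                ≡⟨ ⊛-identityʳ (θ s) n ⟨
  (θ s ⊛ one) n        ≡⟨ ℚₚ.*-identityˡ _ ⟨
  1ℚ * (θ s ⊛ one) n   ∎
  where open ≡-Reasoning
θ-^ˢ s (suc k) n = begin
  θ (s ⊛ sᵏ⁺¹) n                      ≡⟨ θ-⊛ s sᵏ⁺¹ n ⟩
  X + (s ⊛ θ sᵏ⁺¹) n                  ≡⟨ cong (_+_ X) inner ⟩
  X + ιₙ (suc k) * X                  ≡⟨ collect X (ιₙ (suc k)) ⟩
  (1ℚ + ιₙ (suc k)) * X               ≡⟨ cong (_* X) (ιₙ-+ 1 (suc k)) ⟨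
  ιₙ (suc (suc k)) * X                ∎
  where
  open ≡-Reasoning
  sᵏ⁺¹ = s ^ˢ suc k
  X = (θ s ⊛ sᵏ⁺¹) n
  collect : ∀ x y → x + y * x ≡ (1ℚ + y) * x
  collect = solve-∀ ℚ-ring
  inner : (s ⊛ θ sᵏ⁺¹) n ≡ ιₙ (suc k) * X
  inner = begin
    (s ⊛ θ sᵏ⁺¹) n
      ≡⟨ ⊛-congʳ s n (θ-^ˢ s k) ⟩
    (s ⊛ (λ m → ιₙ (suc k) * (θ s ⊛ (s ^ˢ k)) m)) n
      ≡⟨ ⊛-*ʳ (ιₙ (suc k)) s (θ s ⊛ (s ^ˢ k)) n ⟩
    ιₙ (suc k) * (s ⊛ (θ s ⊛ (s ^ˢ k))) n
      ≡⟨ cong (ιₙ (suc k) *_) (⊛-assoc s (θ s) (s ^ˢ k) n) ⟨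
    ιₙ (suc k) * ((s ⊛ θ s) ⊛ (s ^ˢ k)) n
      ≡⟨ cong (ιₙ (suc k) *_) (⊛-congˡ (s ^ˢ k) n (⊛-comm s (θ s))) ⟩
    ιₙ (suc k) * ((θ s ⊛ s) ⊛ (s ^ˢ k)) n
      ≡⟨ cong (ιₙ (suc k) *_) (⊛-assoc (θ s) s (s ^ˢ k) n) ⟩
    ιₙ (suc k) * X ∎

^ˢ-vanish : ∀ s → s 0 ≡ 0ℚ → ∀ k n → n < k → (s ^ˢ k) n ≡ 0ℚ
^ˢ-vanish s s0≡0 (suc k) n n<1+k = sumTo-zero n _ (term n n<1+k)
  where
  term : ∀ n → n < suc k → ∀ i → i ≤ n → s i * (s ^ˢ k) (n ∸ i) ≡ 0ℚ
  term n       _           zero    _ = trans (cong (_* (s ^ˢ k) n) s0≡0) (ℚₚ.*-zeroˡ ((s ^ˢ k) n))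
  term (suc n) (s≤s n<k)   (suc j) _ =
    trans (cong (s (suc j) *_) (^ˢ-vanish s s0≡0 k (n ∸ j) (ℕₚ.≤-<-trans (ℕₚ.m∸n≤m n j) n<k)))
          (ℚₚ.*-zeroʳ (s (suc j)))

^ˢ-diagonal : ∀ s → s 0 ≡ 0ℚ → s 1 ≡ 1ℚ → ∀ k → (s ^ˢ k) k ≡ 1ℚ
^ˢ-diagonal s s0≡0 s1≡1 zero    = refl
^ˢ-diagonal s s0≡0 s1≡1 (suc k) = begin
  (s ⊛ (s ^ˢ k)) (suc k)
    ≡⟨ ⊛-suc s (s ^ˢ k) k ⟩
  s 0 * (s ^ˢ k) (suc k) + (shift s ⊛ (s ^ˢ k)) k
                                         ≡⟨ cong₂ _+_ (trans (cong (_* (s ^ˢ k) (suc k)) s0≡0) (ℚₚ.*-zeroˡ ((s ^ˢ k) (suc k))))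
                                                      (sumTo-single k _ later-vanish) ⟩
  0ℚ + s 1 * (s ^ˢ k) k
    ≡⟨ ℚₚ.+-identityˡ _ ⟩
  s 1 * (s ^ˢ k) k
    ≡⟨ cong₂ _*_ s1≡1 (^ˢ-diagonal s s0≡0 s1≡1 k) ⟩
  1ℚ ∎
  where
  open ≡-Reasoning
  later-vanish : ∀ j → j < k → s (suc (suc j)) * (s ^ˢ k) (k ∸ suc j) ≡ 0ℚ
  later-vanish j j<k =
    trans (cong (s (suc (suc j)) *_) (^ˢ-vanish s s0≡0 k (k ∸ suc j) (ℕₚ.∸-monoʳ-< {k} {suc j} {0} (s≤s z≤n) j<k)))
          (ℚₚ.*-zeroʳ (s (suc (suc j))))

-- Recurrences for the coefficients

θ-Lg : ∀ g j → θ (Lg g) (suc j) ≡ ι (g (suc j))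
θ-Lg g j = ιₙ-*-/ (g (suc j)) j

P-vanish : ∀ g {n k} → n < k → P g n k ≡ 0ℚ
P-vanish g {n} {k} n<k = trans (cong (_* invFact k) (^ˢ-vanish (Lg g) refl k n n<k)) (ℚₚ.*-zeroˡ (invFact k))

A-vanish : ∀ g {n k} → n < k → A g n k ≡ 0ℚ
A-vanish g {n} n<k = trans (cong (ιₙ (n !) *_) (P-vanish g n<k)) (ℚₚ.*-zeroʳ (ιₙ (n !)))

A-suc-zero : ∀ g n → A g (suc n) 0 ≡ 0ℚ
A-suc-zero g n = trans (cong (ιₙ (suc n !) *_) (ℚₚ.*-zeroˡ (invFact 0))) (ℚₚ.*-zeroʳ (ιₙ (suc n !)))

A-diagonal : ∀ g → g 1 ≡ + 1 → ∀ n → A g n n ≡ 1ℚ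
A-diagonal g g1≡1 n = begin
  ιₙ (n !) * ((Lg g ^ˢ n) n * invFact n)
    ≡⟨ cong (λ c → ιₙ (n !) * (c * invFact n)) (^ˢ-diagonal (Lg g) refl (cong ι g1≡1) n) ⟩
  ιₙ (n !) * (1ℚ * invFact n)
    ≡⟨ cong (ιₙ (n !) *_) (ℚₚ.*-identityˡ (invFact n)) ⟩
  ιₙ (n !) * invFact n
    ≡⟨ ιₙ-!-*-invFact n ⟩
  1ℚ ∎
  where open ≡-Reasoning

A-one : ∀ g m → A g (suc m) 1 ≡ ιₙ (m !) * ι (g (suc m))
A-one g m = begin
  ιₙ (suc m ℕ.* m !) * ((Lg g ⊛ one) (suc m) * 1ℚ)
    ≡⟨ cong₂ (λ u v → u * (v * 1ℚ)) (ιₙ-* (suc m) (m !)) (⊛-identityʳ (Lg g) (suc m)) ⟩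
  ιₙ (suc m) * ιₙ (m !) * (Lg g (suc m) * 1ℚ)
    ≡⟨ rearrange (ιₙ (suc m)) (ιₙ (m !)) (Lg g (suc m)) ⟩
  ιₙ (m !) * (ιₙ (suc m) * Lg g (suc m))
    ≡⟨ cong (ιₙ (m !) *_) (θ-Lg g m) ⟩
  ιₙ (m !) * ι (g (suc m)) ∎
  where
  open ≡-Reasoning
  rearrange : ∀ a b l → a * b * (l * 1ℚ) ≡ b * (a * l)
  rearrange = solve-∀ ℚ-ring

P-θ-recurrence : ∀ g n k → ιₙ (suc n) * P g (suc n) (suc k) ≡ sumTo n (λ j → ι (g (suc j)) * P g (n ∸ j) k)
P-θ-recurrence g n k = begin
  ιₙ (suc n) * (Lᵏ⁺¹ (suc n) * invFact (suc k))
    ≡⟨ ℚₚ.*-assoc (ιₙ (suc n)) (Lᵏ⁺¹ (suc n)) (invFact (suc k)) ⟨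
  θ Lᵏ⁺¹ (suc n) * invFact (suc k)
    ≡⟨ cong (_* invFact (suc k)) (θ-^ˢ L k (suc n)) ⟩
  ιₙ (suc k) * (θ L ⊛ Lᵏ) (suc n) * invFact (suc k)
    ≡⟨ rearrange (ιₙ (suc k)) ((θ L ⊛ Lᵏ) (suc n)) (invFact (suc k)) ⟩
  (θ L ⊛ Lᵏ) (suc n) * (ιₙ (suc k) * invFact (suc k))
    ≡⟨ cong ((θ L ⊛ Lᵏ) (suc n) *_) (ιₙ-*-invFact k) ⟩
  (θ L ⊛ Lᵏ) (suc n) * invFact k
    ≡⟨ cong (_* invFact k) (⊛-suc (θ L) Lᵏ n) ⟩
  (0ℚ * Lᵏ (suc n) + (shift (θ L) ⊛ Lᵏ) n) * invFact k
    ≡⟨ cong (λ x → (x + (shift (θ L) ⊛ Lᵏ) n) * invFact k) (ℚₚ.*-zeroˡ (Lᵏ (suc n))) ⟩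
  (0ℚ + (shift (θ L) ⊛ Lᵏ) n) * invFact k
    ≡⟨ cong (_* invFact k) (ℚₚ.+-identityˡ ((shift (θ L) ⊛ Lᵏ) n)) ⟩
  (shift (θ L) ⊛ Lᵏ) n * invFact k
    ≡⟨ sumTo-*ʳ n (invFact k) _ ⟨
  sumTo n (λ j → θ L (suc j) * Lᵏ (n ∸ j) * invFact k)
    ≡⟨ sumTo-cong n (λ j _ → trans (ℚₚ.*-assoc (θ L (suc j)) (Lᵏ (n ∸ j)) (invFact k)) (cong (_* P g (n ∸ j) k) (θ-Lg g j))) ⟩
  sumTo n (λ j → ι (g (suc j)) * P g (n ∸ j) k) ∎
  where
  open ≡-Reasoning
  L = Lg g
  Lᵏ = L ^ˢ k
  Lᵏ⁺¹ = L ^ˢ suc k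
  rearrange : ∀ a x b → a * x * b ≡ x * (a * b)
  rearrange = solve-∀ ℚ-ring

P-⊛-recurrence : ∀ g n k → ιₙ (suc k) * P g n (suc k) ≡ sumTo n (λ i → Lg g i * P g (n ∸ i) k)
P-⊛-recurrence g n k = begin
  ιₙ (suc k) * ((L ^ˢ suc k) n * invFact (suc k))
    ≡⟨ ℚₚ.*-comm (ιₙ (suc k)) _ ⟩
  (L ^ˢ suc k) n * invFact (suc k) * ιₙ (suc k)
    ≡⟨ ℚₚ.*-assoc ((L ^ˢ suc k) n) (invFact (suc k)) (ιₙ (suc k)) ⟩
  (L ^ˢ suc k) n * (invFact (suc k) * ιₙ (suc k))
    ≡⟨ cong ((L ^ˢ suc k) n *_) (trans (ℚₚ.*-comm (invFact (suc k)) (ιₙ (suc k))) (ιₙ-*-invFact k)) ⟩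
  (L ⊛ (L ^ˢ k)) n * invFact k
    ≡⟨ sumTo-*ʳ n (invFact k) _ ⟨
  sumTo n (λ i → L i * (L ^ˢ k) (n ∸ i) * invFact k)
    ≡⟨ sumTo-cong n (λ i _ → ℚₚ.*-assoc (L i) _ (invFact k)) ⟩
  sumTo n (λ i → L i * P g (n ∸ i) k) ∎
  where
  open ≡-Reasoning
  L = Lg g

A-θ-recurrence : ∀ g n k → A g (suc n) (suc k) ≡ sumTo n (λ j → ι (g (suc j)) * (ιₙ (n !) * P g (n ∸ j) k))
A-θ-recurrence g n k = begin
  ιₙ (suc n ℕ.* n !) * P g (suc n) (suc k)
    ≡⟨ cong (_* P g (suc n) (suc k)) (ιₙ-* (suc n) (n !)) ⟩
  ιₙ (suc n) * ιₙ (n !) * P g (suc n) (suc k)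
    ≡⟨ rearrange (ιₙ (suc n)) (ιₙ (n !)) (P g (suc n) (suc k)) ⟩
  ιₙ (n !) * (ιₙ (suc n) * P g (suc n) (suc k))
    ≡⟨ cong (ιₙ (n !) *_) (P-θ-recurrence g n k) ⟩
  ιₙ (n !) * sumTo n (λ j → ι (g (suc j)) * P g (n ∸ j) k)
    ≡⟨ sumTo-*ˡ n (ιₙ (n !)) _ ⟨
  sumTo n (λ j → ιₙ (n !) * (ι (g (suc j)) * P g (n ∸ j) k))
    ≡⟨ sumTo-cong n (λ j _ → swap (ιₙ (n !)) (ι (g (suc j))) (P g (n ∸ j) k)) ⟩
  sumTo n (λ j → ι (g (suc j)) * (ιₙ (n !) * P g (n ∸ j) k)) ∎
  where
  open ≡-Reasoning
  rearrange : ∀ a b x → a * b * x ≡ b * (a * x)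
  rearrange = solve-∀ ℚ-ring
  swap : ∀ a b x → a * (b * x) ≡ b * (a * x)
  swap = solve-∀ ℚ-ring

A-⊛-recurrence : ∀ g n k → ιₙ (suc k) * A g n (suc k) ≡ sumTo n (λ i → ιₙ (n !) * (Lg g i * P g (n ∸ i) k))
A-⊛-recurrence g n k = begin
  ιₙ (suc k) * (ιₙ (n !) * P g n (suc k))                  ≡⟨ swap (ιₙ (suc k)) (ιₙ (n !)) (P g n (suc k)) ⟩
  ιₙ (n !) * (ιₙ (suc k) * P g n (suc k))                  ≡⟨ cong (ιₙ (n !) *_) (P-⊛-recurrence g n k) ⟩
  ιₙ (n !) * sumTo n (λ i → Lg g i * P g (n ∸ i) k)        ≡⟨ sumTo-*ˡ n (ιₙ (n !)) _ ⟨
  sumTo n (λ i → ιₙ (n !) * (Lg g i * P g (n ∸ i) k))      ∎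
  where
  open ≡-Reasoning
  swap : ∀ a b x → a * (b * x) ≡ b * (a * x)
  swap = solve-∀ ℚ-ring

-- Integrality and divisibility by p

IsIntegral : ℚ → Set
IsIntegral x = ∃ λ z → x ≡ ι z

integral-+ : ∀ {x y} → IsIntegral x → IsIntegral y → IsIntegral (x + y)
integral-+ (a , refl) (b , refl) = a ℤ.+ b , sym (ι-+ a b)

integral-* : ∀ {x y} → IsIntegral x → IsIntegral y → IsIntegral (x * y)
integral-* (a , refl) (b , refl) = a ℤ.* b , sym (ι-* a b)

factorial-*-P-integral : ∀ g {m n} k → m ≤ n → IsIntegral (A g m k) → IsIntegral (ιₙ (n !) * P g m k)
factorial-*-P-integral g {m} {n} k m≤n A-int with m≤n⇒m!∣n! m≤n
... | divides t n!≡t*m! = subst IsIntegral (sym factor) (integral-* (+ t , refl) A-int)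
  where
  factor : ιₙ (n !) * P g m k ≡ ιₙ t * A g m k
  factor = begin
    ιₙ (n !) * P g m k               ≡⟨ cong (λ x → ιₙ x * P g m k) n!≡t*m! ⟩
    ιₙ (t ℕ.* m !) * P g m k         ≡⟨ cong (_* P g m k) (ιₙ-* t (m !)) ⟩
    ιₙ t * ιₙ (m !) * P g m k        ≡⟨ ℚₚ.*-assoc (ιₙ t) (ιₙ (m !)) (P g m k) ⟩
    ιₙ t * A g m k                   ∎
    where open ≡-Reasoning

A-integral : ∀ g n k → IsIntegral (A g n k)
A-integral g zero    zero    = + 1 , refl
A-integral g (suc n) zero    = + 0 , A-suc-zero g n
A-integral g zero    (suc k) = + 0 , A-vanish g {0} {suc k} (s≤s z≤n)
A-integral g (suc n) (suc k) =
  subst IsIntegral (sym (A-θ-recurrence g n k)) (sumTo-closed IsIntegral integral-+ n _ term)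
  where
  term : ∀ j → j ≤ n → IsIntegral (ι (g (suc j)) * (ιₙ (n !) * P g (n ∸ j) k))
  term j _ =
    integral-* (g (suc j) , refl) (factorial-*-P-integral g k (ℕₚ.m∸n≤m n j) (A-integral g (n ∸ j) k))

MultipleOf : ℕ → ℚ → Set
MultipleOf p x = ∃ λ z → x ≡ ι (+ p ℤ.* z)

multiple-≡0 : ∀ {p x} → x ≡ 0ℚ → MultipleOf p x
multiple-≡0 {p} x≡0 = + 0 , trans x≡0 (cong ι (sym (ℤₚ.*-zeroʳ (+ p))))

multiple-+ : ∀ {p x y} → MultipleOf p x → MultipleOf p y → MultipleOf p (x + y)
multiple-+ {p} (a , refl) (b , refl) =
  a ℤ.+ b , trans (sym (ι-+ (+ p ℤ.* a) (+ p ℤ.* b))) (cong ι (sym (ℤₚ.*-distribˡ-+ (+ p) a b)))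

multiple-- : ∀ {p x y} → MultipleOf p x → MultipleOf p y → MultipleOf p (x - y)
multiple-- {p} (a , refl) (b , refl) = a ℤ.- b , (begin
  ι (+ p ℤ.* a) - ι (+ p ℤ.* b)
    ≡⟨ cong (λ z → ι z - ι (+ p ℤ.* b)) (split (+ p) a b) ⟩
  ι (+ p ℤ.* (a ℤ.- b) ℤ.+ + p ℤ.* b) - ι (+ p ℤ.* b)
    ≡⟨ cong (_- ι (+ p ℤ.* b)) (ι-+ (+ p ℤ.* (a ℤ.- b)) (+ p ℤ.* b)) ⟩
  ι (+ p ℤ.* (a ℤ.- b)) + ι (+ p ℤ.* b) - ι (+ p ℤ.* b)
    ≡⟨ cancel (ι (+ p ℤ.* (a ℤ.- b))) (ι (+ p ℤ.* b)) ⟩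
  ι (+ p ℤ.* (a ℤ.- b))                                 ∎)
  where
  open ≡-Reasoning
  split : ∀ p a b → p ℤ.* a ≡ p ℤ.* (a ℤ.- b) ℤ.+ p ℤ.* b
  split = ℤ-solve-∀
  cancel : ∀ u v → u + v - v ≡ u
  cancel = solve-∀ ℚ-ring

multiple-ιₙ-* : ∀ {p x} → IsIntegral x → MultipleOf p (ιₙ p * x)
multiple-ιₙ-* {p} (a , refl) = a , sym (ι-* (+ p) a)

multiple-*ʳ : ∀ {p x y} → MultipleOf p x → IsIntegral y → MultipleOf p (x * y)
multiple-*ʳ {p} (a , refl) (b , refl) =
  a ℤ.* b , trans (sym (ι-* (+ p ℤ.* a) b)) (cong ι (ℤₚ.*-assoc (+ p) a b))

multiple-sumTo-init : ∀ {p} n (f : ℕ → ℚ) → (∀ j → j < n → MultipleOf p (f j)) → MultipleOf p (sumTo n f - f n)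
multiple-sumTo-init {p} zero f _ = multiple-≡0 {p} (ℚₚ.+-inverseʳ (f 0))
multiple-sumTo-init {p} (suc n) f init-mult =
  subst (MultipleOf p) (sym (cancel (sumTo n f) (f (suc n))))
        (sumTo-closed (MultipleOf p) (multiple-+ {p}) n f (λ j j≤n → init-mult j (s≤s j≤n)))
  where
  cancel : ∀ u v → u + v - v ≡ u
  cancel = solve-∀ ℚ-ring

prime-cancel : ∀ {p a} z w → Prime p → 0 < a → a < p → + a ℤ.* z ≡ + p ℤ.* w → ∃ λ v → z ≡ + p ℤ.* v
prime-cancel {p} {a} z w pr 0<a a<p a*z≡p*w
  with euclidsLemma a ℤ.∣ z ∣ pr (divides ℤ.∣ w ∣ (begin
    a ℕ.* ℤ.∣ z ∣     ≡⟨ ℤₚ.abs-* (+ a) z ⟨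
    ℤ.∣ + a ℤ.* z ∣   ≡⟨ cong ℤ.∣_∣ a*z≡p*w ⟩
    ℤ.∣ + p ℤ.* w ∣   ≡⟨ ℤₚ.abs-* (+ p) w ⟩
    p ℕ.* ℤ.∣ w ∣     ≡⟨ ℕₚ.*-comm p ℤ.∣ w ∣ ⟩
    ℤ.∣ w ∣ ℕ.* p     ∎))
  where open ≡-Reasoning
... | inj₁ p∣a = ⊥-elim (ℕₚ.<⇒≱ a<p (∣⇒≤ {{ℕ.>-nonZero 0<a}} p∣a))
... | inj₂ p∣∣z∣ with ∣ᵤ⇒∣ {+ p} {z} p∣∣z∣
...   | Signed.divides v z≡v*p = v , trans z≡v*p (ℤₚ.*-comm v (+ p))

multiple-cancel : ∀ {p a x} → Prime p → 0 < a → a < p → IsIntegral x → MultipleOf p (ιₙ a * x) → MultipleOf p x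
multiple-cancel {p} {a} pr 0<a a<p (z , refl) (w , ιa*ιz≡ι[p*w])
  with prime-cancel z w pr 0<a a<p (ι-injective {+ a ℤ.* z} {+ p ℤ.* w} (trans (ι-* (+ a) z) ιa*ιz≡ι[p*w]))
... | v , z≡p*v = v , cong ι z≡p*v

prime∤! : ∀ {p n} → Prime p → n < p → ¬ p ∣ n !
prime∤! {p} {zero}  pr _     p∣1  = ℕₚ.<⇒≱ (ℕ.nonTrivial⇒n>1 p {{prime⇒nonTrivial pr}}) (∣⇒≤ p∣1)
prime∤! {p} {suc n} pr 1+n<p p∣[1+n]! with euclidsLemma (suc n) (n !) pr p∣[1+n]!
... | inj₁ p∣1+n = ℕₚ.<⇒≱ 1+n<p (∣⇒≤ p∣1+n)
... | inj₂ p∣n!  = prime∤! pr (ℕₚ.<-trans (ℕₚ.n<1+n n) 1+n<p) p∣n!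

prime-factorial-split : ∀ {m j} → Prime (suc m) → suc j < suc m →
                        ∃ λ t → suc m ! ≡ suc m ℕ.* t ℕ.* (suc j ! ℕ.* (m ∸ j) !)
prime-factorial-split {m} {j} pr j+1<p with k![n∸k]!∣n! {suc m} {suc j} (ℕₚ.<⇒≤ j+1<p)
... | divides q p!≡q*d
  with euclidsLemma q (suc j ! ℕ.* (m ∸ j) !) pr (divides (m !) (trans (sym p!≡q*d) (ℕₚ.*-comm (suc m) (m !))))
...   | inj₁ (divides t q≡t*p) = t , trans p!≡q*d (cong (ℕ._* _) (trans q≡t*p (ℕₚ.*-comm t (suc m))))
...   | inj₂ p∣d with euclidsLemma (suc j !) ((m ∸ j) !) pr p∣d
...     | inj₁ p∣[j+1]! = ⊥-elim (prime∤! pr j+1<p p∣[j+1]!)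
...     | inj₂ p∣[m-j]! = ⊥-elim (prime∤! pr (s≤s (ℕₚ.m∸n≤m m j)) p∣[m-j]!)

interior-term : ∀ g {m j} k → Prime (suc m) → suc j < suc m →
                MultipleOf (suc m) (ιₙ (suc m !) * (Lg g (suc j) * P g (m ∸ j) k))
interior-term g {m} {j} k pr j+1<p with prime-factorial-split pr j+1<p
... | t , p!-split =
  subst (MultipleOf (suc m)) (sym factor)
        (multiple-ιₙ-* {suc m} (integral-* (integral-* (+ t , refl) (+ (j !) , refl))
                                   (integral-* (g (suc j) , refl) (A-integral g r k))))
  where
  r = m ∸ j
  rearrange : ∀ p t s j! r! l x → p * t * (s * j! * r!) * (l * x) ≡ p * (t * j! * (s * l * (r! * x)))
  rearrange = solve-∀ ℚ-ring
  ιₙ-expand : ιₙ (suc m ℕ.* t ℕ.* (suc j ℕ.* j ! ℕ.* r !)) ≡ ιₙ (suc m) * ιₙ t * (ιₙ (suc j) * ιₙ (j !) * ιₙ (r !))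
  ιₙ-expand = trans (ιₙ-* (suc m ℕ.* t) _)
    (cong₂ _*_ (ιₙ-* (suc m) t) (trans (ιₙ-* (suc j ℕ.* j !) (r !)) (cong (_* ιₙ (r !)) (ιₙ-* (suc j) (j !)))))
  factor : ιₙ (suc m !) * (Lg g (suc j) * P g r k) ≡ ιₙ (suc m) * (ιₙ t * ιₙ (j !) * (ι (g (suc j)) * A g r k))
  factor = begin
    ιₙ (suc m !) * (Lg g (suc j) * P g r k)
      ≡⟨ cong (λ n → ιₙ n * (Lg g (suc j) * P g r k)) p!-split ⟩
    ιₙ (suc m ℕ.* t ℕ.* (suc j ℕ.* j ! ℕ.* r !)) * (Lg g (suc j) * P g r k)
      ≡⟨ cong (_* (Lg g (suc j) * P g r k)) ιₙ-expand ⟩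
    ιₙ (suc m) * ιₙ t * (ιₙ (suc j) * ιₙ (j !) * ιₙ (r !)) * (Lg g (suc j) * P g r k)
      ≡⟨ rearrange (ιₙ (suc m)) (ιₙ t) (ιₙ (suc j)) (ιₙ (j !)) (ιₙ (r !)) (Lg g (suc j)) (P g r k) ⟩
    ιₙ (suc m) * (ιₙ t * ιₙ (j !) * (ιₙ (suc j) * Lg g (suc j) * A g r k))
      ≡⟨ cong (λ y → ιₙ (suc m) * (ιₙ t * ιₙ (j !) * (y * A g r k))) (θ-Lg g j) ⟩
    ιₙ (suc m) * (ιₙ t * ιₙ (j !) * (ι (g (suc j)) * A g r k))
      ∎
    where open ≡-Reasoning

A-prime-interior : ∀ g {m k} → Prime (suc m) → 1 ≤ k → suc k < suc m → MultipleOf (suc m) (A g (suc m) (suc k))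
A-prime-interior g {m} {k} pr 1≤k k+1<p =
  multiple-cancel pr (s≤s z≤n) k+1<p (A-integral g (suc m) (suc k))
    (subst (MultipleOf (suc m)) (sym (A-⊛-recurrence g (suc m) k))
           (sumTo-closed (MultipleOf (suc m)) (multiple-+ {suc m}) (suc m) _ term))
  where
  term : ∀ i → i ≤ suc m → MultipleOf (suc m) (ιₙ (suc m !) * (Lg g i * P g (suc m ∸ i) k))
  term zero    _ = multiple-≡0 {suc m}
    (trans (cong (ιₙ (suc m !) *_) (ℚₚ.*-zeroˡ (P g (suc m) k))) (ℚₚ.*-zeroʳ (ιₙ (suc m !))))
  term (suc j) (s≤s j≤m) with ℕₚ.m≤n⇒m<n∨m≡n j≤m
  ... | inj₁ j<m  = interior-term g k pr (s≤s j<m)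
  ... | inj₂ refl = multiple-≡0 {suc m}
    (trans (cong (λ x → ιₙ (suc m !) * (Lg g (suc m) * x)) (P-vanish g (subst (_< k) (sym (ℕₚ.n∸n≡0 m)) 1≤k)))
           (trans (cong (ιₙ (suc m !) *_) (ℚₚ.*-zeroʳ (Lg g (suc m)))) (ℚₚ.*-zeroʳ (ιₙ (suc m !)))))

A-prime-off-diagonal : ∀ g {m k} → Prime (suc m) → k ≢ 1 → k ≢ suc m → MultipleOf (suc m) (A g (suc m) k)
A-prime-off-diagonal g {m} {zero}        pr k≢1 k≢p = multiple-≡0 {suc m} (A-suc-zero g m)
A-prime-off-diagonal g {m} {suc zero}    pr k≢1 k≢p = ⊥-elim (k≢1 refl)
A-prime-off-diagonal g {m} {suc (suc j)} pr k≢1 k≢p with ℕₚ.<-cmp (suc (suc j)) (suc m)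
... | tri< k<p _ _ = A-prime-interior g pr (s≤s z≤n) k<p
... | tri≈ _ k≡p _ = ⊥-elim (k≢p k≡p)
... | tri> _ _ k>p = multiple-≡0 {suc m} (A-vanish g k>p)

-- Wilson's theorem, from the case g ≡ 1

𝟙 : ℕ → ℤ
𝟙 _ = + 1

P𝟙-recurrence : ∀ n k → ιₙ (suc n) * P 𝟙 (suc n) (suc k) ≡ P 𝟙 n k + ιₙ n * P 𝟙 n (suc k)
P𝟙-recurrence zero    k = trans (P-θ-recurrence 𝟙 0 k) (pad (P 𝟙 0 k) (P 𝟙 0 (suc k)))
  where
  pad : ∀ x y → 1ℚ * x ≡ x + 0ℚ * y
  pad = solve-∀ ℚ-ring
P𝟙-recurrence (suc n) k = begin
  ιₙ (suc (suc n)) * P 𝟙 (suc (suc n)) (suc k)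
    ≡⟨ P-θ-recurrence 𝟙 (suc n) k ⟩
  sumTo (suc n) (λ j → 1ℚ * P 𝟙 (suc n ∸ j) k)
    ≡⟨ sumTo-head n _ ⟩
  1ℚ * P 𝟙 (suc n) k + sumTo n (λ j → 1ℚ * P 𝟙 (n ∸ j) k)
    ≡⟨ cong₂ _+_ (ℚₚ.*-identityˡ (P 𝟙 (suc n) k)) (sym (P-θ-recurrence 𝟙 n k)) ⟩
  P 𝟙 (suc n) k + ιₙ (suc n) * P 𝟙 (suc n) (suc k) ∎
  where open ≡-Reasoning

A𝟙-recurrence : ∀ n k → A 𝟙 (suc n) (suc k) ≡ A 𝟙 n k + ιₙ n * A 𝟙 n (suc k)
A𝟙-recurrence n k = begin
  ιₙ (suc n ℕ.* n !) * P 𝟙 (suc n) (suc k)           ≡⟨ cong (_* P 𝟙 (suc n) (suc k)) (ιₙ-* (suc n) (n !)) ⟩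
  ιₙ (suc n) * ιₙ (n !) * P 𝟙 (suc n) (suc k)        ≡⟨ swap (ιₙ (suc n)) (ιₙ (n !)) (P 𝟙 (suc n) (suc k)) ⟩
  ιₙ (n !) * (ιₙ (suc n) * P 𝟙 (suc n) (suc k))      ≡⟨ cong (ιₙ (n !) *_) (P𝟙-recurrence n k) ⟩
  ιₙ (n !) * (P 𝟙 n k + ιₙ n * P 𝟙 n (suc k))        ≡⟨ expand (ιₙ (n !)) (P 𝟙 n k) (ιₙ n) (P 𝟙 n (suc k)) ⟩
  A 𝟙 n k + ιₙ n * A 𝟙 n (suc k)                     ∎
  where
  open ≡-Reasoning
  swap : ∀ a b x → a * b * x ≡ b * (a * x)
  swap = solve-∀ ℚ-ring
  expand : ∀ f x a y → f * (x + a * y) ≡ f * x + a * (f * y)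
  expand = solve-∀ ℚ-ring

A𝟙-row-sum : ∀ n → sumTo n (A 𝟙 n) ≡ ιₙ (n !)
A𝟙-row-sum zero    = refl
A𝟙-row-sum (suc n) = begin
  sumTo (suc n) (A 𝟙 (suc n))
    ≡⟨ sumTo-head n (A 𝟙 (suc n)) ⟩
  A 𝟙 (suc n) 0 + sumTo n (λ k → A 𝟙 (suc n) (suc k))
    ≡⟨ cong₂ _+_ (A-suc-zero 𝟙 n) (sumTo-cong n (λ k _ → A𝟙-recurrence n k)) ⟩
  0ℚ + sumTo n (λ k → A 𝟙 n k + ιₙ n * A 𝟙 n (suc k))
    ≡⟨ ℚₚ.+-identityˡ _ ⟩
  sumTo n (λ k → A 𝟙 n k + ιₙ n * A 𝟙 n (suc k))
    ≡⟨ sumTo-+ n (A 𝟙 n) _ ⟩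
  sumTo n (A 𝟙 n) + sumTo n (λ k → ιₙ n * A 𝟙 n (suc k))
    ≡⟨ cong (_+_ (sumTo n (A 𝟙 n))) (trans (sumTo-*ˡ n (ιₙ n) _) (shifted n)) ⟩
  sumTo n (A 𝟙 n) + ιₙ n * sumTo n (A 𝟙 n)
    ≡⟨ cong (λ s → s + ιₙ n * s) (A𝟙-row-sum n) ⟩
  ιₙ (n !) + ιₙ n * ιₙ (n !)
    ≡⟨ collect (ιₙ (n !)) (ιₙ n) ⟩
  (1ℚ + ιₙ n) * ιₙ (n !)
    ≡⟨ cong (_* ιₙ (n !)) (ιₙ-+ 1 n) ⟨
  ιₙ (suc n) * ιₙ (n !)
    ≡⟨ ιₙ-* (suc n) (n !) ⟨
  ιₙ (suc n !) ∎
  where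
  open ≡-Reasoning
  collect : ∀ f a → f + a * f ≡ (1ℚ + a) * f
  collect = solve-∀ ℚ-ring
  shifted : ∀ n → ιₙ n * sumTo n (λ k → A 𝟙 n (suc k)) ≡ ιₙ n * sumTo n (A 𝟙 n)
  shifted zero    = trans (ℚₚ.*-zeroˡ (A 𝟙 0 1)) (sym (ℚₚ.*-zeroˡ (A 𝟙 0 0)))
  shifted (suc n) = cong (ιₙ (suc n) *_)
    (sumTo-shift (suc n) (A 𝟙 (suc n)) (A-suc-zero 𝟙 n) (A-vanish 𝟙 (ℕₚ.n<1+n (suc n))))

wilson : ∀ {m} → Prime (suc m) → MultipleOf (suc m) (ιₙ (m !) + 1ℚ)
wilson {zero}  (prime {{()}} _)
wilson {suc r} pr = subst (MultipleOf p) (sym identity)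
  (multiple-- {p} (multiple-ιₙ-* {p} (+ (suc r !) , refl)) (multiple-sumTo-init {p} r h interior))
  where
  p = suc (suc r)
  h : ℕ → ℚ
  h j = A 𝟙 p (suc (suc j))
  interior : ∀ j → j < r → MultipleOf p (h j)
  interior j j<r = A-prime-interior 𝟙 pr (s≤s z≤n) (s≤s (s≤s j<r))
  row : 0ℚ + (ιₙ (suc r !) * 1ℚ + sumTo r h) ≡ ιₙ p * ιₙ (suc r !)
  row = begin
    0ℚ + (ιₙ (suc r !) * 1ℚ + sumTo r h)
      ≡⟨ cong₂ (λ a b → a + (b + sumTo r h)) (A-suc-zero 𝟙 (suc r)) (A-one 𝟙 (suc r)) ⟨
    A 𝟙 p 0 + (A 𝟙 p 1 + sumTo r h)
      ≡⟨ cong (_+_ (A 𝟙 p 0)) (sumTo-head r (A 𝟙 p ∘ suc)) ⟨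
    A 𝟙 p 0 + sumTo (suc r) (A 𝟙 p ∘ suc)
      ≡⟨ sumTo-head (suc r) (A 𝟙 p) ⟨
    sumTo p (A 𝟙 p)
      ≡⟨ A𝟙-row-sum p ⟩
    ιₙ (p !)
      ≡⟨ ιₙ-* p (suc r !) ⟩
    ιₙ p * ιₙ (suc r !) ∎
    where open ≡-Reasoning
  reassemble : ∀ a y → a + 1ℚ ≡ 0ℚ + (a * 1ℚ + y) - (y - 1ℚ)
  reassemble = solve-∀ ℚ-ring
  identity : ιₙ (suc r !) + 1ℚ ≡ ιₙ p * ιₙ (suc r !) - (sumTo r h - h r)
  identity = begin
    ιₙ (suc r !) + 1ℚ
      ≡⟨ reassemble (ιₙ (suc r !)) (sumTo r h) ⟩
    0ℚ + (ιₙ (suc r !) * 1ℚ + sumTo r h) - (sumTo r h - 1ℚ)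
      ≡⟨ cong₂ (λ a b → a - (sumTo r h - b)) row (sym (A-diagonal 𝟙 refl p)) ⟩
    ιₙ p * ιₙ (suc r !) - (sumTo r h - h r) ∎
    where open ≡-Reasoning

rhs-off : ∀ g {p k} → p ≢ k → k ≢ 1 → rhs g p k ≡ 0ℚ - 0ℚ * ι (g p)
rhs-off g {p} {k} p≢k k≢1 with p ≟ k | 1 ≟ k
... | yes p≡k | _       = ⊥-elim (p≢k p≡k)
... | no _    | yes 1≡k = ⊥-elim (k≢1 (sym 1≡k))
... | no _    | no _    = refl

rhs-one : ∀ g {p} → p ≢ 1 → rhs g p 1 ≡ 0ℚ - 1ℚ * ι (g p)
rhs-one g {p} p≢1 with p ≟ 1
... | yes p≡1 = ⊥-elim (p≢1 p≡1)
... | no _    = refl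

rhs-diagonal : ∀ g {p} → p ≢ 1 → rhs g p p ≡ 1ℚ - 0ℚ * ι (g p)
rhs-diagonal g {p} p≢1 with p ≟ p | 1 ≟ p
... | no p≢p | _       = ⊥-elim (p≢p refl)
... | yes _  | yes 1≡p = ⊥-elim (p≢1 (sym 1≡p))
... | yes _  | no _    = refl

prime⇒≢1 : ∀ {p} → Prime p → p ≢ 1
prime⇒≢1 pr = ℕ.nonTrivial⇒≢1 {{prime⇒nonTrivial pr}}

proposition1 : (g : ℕ → ℤ) → g 1 ≡ + 1 →
    (p : ℕ) → Prime p →
    (k : ℕ) → ∃ λ (z : ℤ) → A g p k - rhs g p k ≡ ((+ p Data.Integer.* z) / 1)
proposition1 g g1≡1 zero (prime {{()}} _)
proposition1 g g1≡1 p@(suc m) pr k with k ≟ 1 | k ≟ p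
... | yes refl | _ = subst (MultipleOf p) (sym coefficient) (multiple-*ʳ {p} (wilson pr) (g p , refl))
  where
  factor : ∀ a x → a * x - (0ℚ - 1ℚ * x) ≡ (a + 1ℚ) * x
  factor = solve-∀ ℚ-ring
  coefficient : A g p 1 - rhs g p 1 ≡ (ιₙ (m !) + 1ℚ) * ι (g p)
  coefficient = trans (cong₂ _-_ (A-one g m) (rhs-one g (prime⇒≢1 pr))) (factor (ιₙ (m !)) (ι (g p)))
... | no _ | yes refl = multiple-≡0 {p} coefficient
  where
  cancel : ∀ x → 1ℚ - (1ℚ - 0ℚ * x) ≡ 0ℚ
  cancel = solve-∀ ℚ-ring
  coefficient : A g p p - rhs g p p ≡ 0ℚ
  coefficient = trans (cong₂ _-_ (A-diagonal g g1≡1 p) (rhs-diagonal g (prime⇒≢1 pr))) (cancel (ι (g p)))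
... | no k≢1 | no k≢p = subst (MultipleOf p) (sym coefficient) (A-prime-off-diagonal g pr k≢1 k≢p)
  where
  drop : ∀ a x → a - (0ℚ - 0ℚ * x) ≡ a
  drop = solve-∀ ℚ-ring
  coefficient : A g p k - rhs g p k ≡ A g p k
  coefficient = trans (cong (_-_ (A g p k)) (rhs-off g (k≢p ∘ sym) k≢1)) (drop (A g p k) (ι (g p)))
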